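{- Let $\mathcal X = \mathcal X^{(1)}\times\dots\times\mathcal X^{(k)}$ be a finite product set and let $Q \subseteq \mathcal X$ be such that the graph $F_{\mathcal X, Q}$ is connected. Then for every $n\in\mathbb N$ there exists a $k$-player game $\mathcal G = (\mathcal X, \mathcal A, \mu, Q, V)$ with $\mu$ the uniform distribution on $Q$ and $|\mathcal A| = n^k\cdot|\mathcal X|^n$, such that $\mathrm{val}(\mathcal G^n) = E_Q(n)$.
   Context: $F_{\mathcal X,Q}$ is the undirected $k$-partite graph with vertex set the disjoint union $\mathcal X^{(1)}\cup\dots\cup\mathcal X^{(k)}$ and with an edge $\{x^{(i)},x^{(j)}\}$ for every $(x^{(1)},\dots,x^{(k)})\in Q$ and every $i\ne j$. A $k$-player game is a tuple $\mathcal G = (\mathcal X, \mathcal A, \mu, Q, V)$ where $\mathcal X$ and $\mathcal A = \mathcal A^{(1)}\times\dots\times\mathcal A^{(k)}$ are finite product sets, $\mu$ is a distribution on $\mathcal X$ with support $Q$, and $V:\mathcal X\times\mathcal A\to\{0,1\}$. Its value is $\mathrm{val}(\mathcal G) = \max \Pr_{X\sim\mu}[V(X, f^{(1)}(X^{(1)}),\dots,f^{(k)}(X^{(k)}))=1]$ over all functions $f^{(j)}:\mathcal X^{(j)}\to\mathcal A^{(j)}$. The $n$-fold repetition $\mathcal G^n = (\mathcal X^n, \mathcal A^n, \mu^n, Q^n, V^n)$ has player $j$ receive $x^{(j)}\in(\mathcal X^{(j)})^n$ and answer in $(\mathcal A^{(j)})^n$, distribution $\mu^n(x)=\prod_i\mu(x_i)$,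 predicate $V^n(x,a)=\prod_{i=1}^n V(x_i,a_i)$. For $x\in\mathcal X^n$, $x_i$ is the coordinate-$i$ question tuple, $x^{(j)}$ player $j$'s question vector, $x_i^{(j)}$ its $i$-th entry. Let $q=|Q|$. A set $W\subseteq Q^n$ contains a forbidden subgraph if there are $e(1),\dots,e(q)\in W$ and $i\in[n]$ such that (1) $\{e(1)_i,\dots,e(q)_i\}=Q$ and (2) for every $j\in[k]$ and $r,r'\in[q]$, $e(r)^{(j)}_i=e(r')^{(j)}_i$ implies $e(r)^{(j)}=e(r')^{(j)}$. $E_Q(n)$ is the maximum of $|W|/q^n$ over all $W\subseteq Q^n$ containing no forbidden subgraph. -}

module Defs where

open import Function using (_∘_)
open import Data.Nat using (ℕ; zero; suc; _*_; _^_; NonZero)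
open import Data.Nat.Properties using (m^n≢0)
open import Data.Fin using (Fin)
open import Data.Vec using (Vec; []; _∷_; lookup)
import Data.Vec as Vec
open import Data.List using (List; []; _∷_; concatMap; allFin)
open import Data.Bool.ListAction using (and)
open import Data.Nat.ListAction using (sum)
import Data.List as List
open import Data.Bool using (Bool; true; false; if_then_else_)
open import Data.Product using (Σ; _×_; ∃; _,_)
open import Data.Integer using (+_)
open import Data.Rational using (ℚ; _/_; _≤_)
open import Relation.Nullary using (¬_)
open import Relation.Binary.PropositionalEquality using (_≡_; _≢_)
open import Relation.Binary.Construct.Closure.ReflexiveTransitive using (Star)

prodFin : (k : ℕ) → (Fin k → ℕ) → ℕ
prodFin zero    f = 1
prodFin (suc k) f = f Fin.zero * prodFin k (f ∘ Fin.suc)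

Tuple : (k : ℕ) → (Fin k → ℕ) → Set
Tuple k s = (j : Fin k) → Fin (s j)

allVecs : (q n : ℕ) → List (Vec (Fin q) n)
allVecs q zero    = [] ∷ []
allVecs q (suc n) = concatMap (λ r → List.map (r ∷_) (allVecs q n)) (allFin q)

count : (q n : ℕ) → (Vec (Fin q) n → Bool) → ℕ
count q n P = sum (List.map (λ e → if P e then 1 else 0) (allVecs q n))

frac : (c q n : ℕ) → .{{NonZero q}} → ℚ
frac c q n = _/_ (+ c) (q ^ n) {{m^n≢0 q n}}

-- Setting: k players, player j's question set is Fin (m j).
-- The set Q ⊆ X is given as an injective enumeration Q : Fin q → X,
-- so an element of Qⁿ is encoded by its index vector e : Vec (Fin q) n
-- (the i-th question tuple being Q (lookup e i)).

DistinctQ : (k : ℕ) (m : Fin k → ℕ) (q : ℕ) → (Fin q → Tuple k m) → Set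
DistinctQ k m q Q = ∀ r r' → (∀ j → Q r j ≡ Q r' j) → r ≡ r'

Vertex : (k : ℕ) (m : Fin k → ℕ) → Set
Vertex k m = Σ (Fin k) (λ j → Fin (m j))

Edge : (k : ℕ) (m : Fin k → ℕ) (q : ℕ) → (Fin q → Tuple k m) →
       Vertex k m → Vertex k m → Set
Edge k m q Q (i , x) (j , y) = i ≢ j × ∃ (λ r → Q r i ≡ x × Q r j ≡ y)

Connected : (k : ℕ) (m : Fin k → ℕ) (q : ℕ) → (Fin q → Tuple k m) → Set
Connected k m q Q = ∀ u v → Star (Edge k m q Q) u v

playerVec : {k : ℕ} {m : Fin k → ℕ} {q n : ℕ} → (Fin q → Tuple k m) →
            (j : Fin k) → Vec (Fin q) n → Vec (Fin (m j)) n
playerVec Q j e = Vec.map (λ r → Q r j) e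

-- The n-fold repeated game Gⁿ of G = (X, A, uniform on Q, Q, V),
-- with A⁽ʲ⁾ = Fin (a j) and V : X × A → {0,1}.

Strategy : (k : ℕ) (m a : Fin k → ℕ) (n : ℕ) → Set
Strategy k m a n = (j : Fin k) → Vec (Fin (m j)) n → Vec (Fin (a j)) n

wins : (k : ℕ) (m a : Fin k → ℕ) (q n : ℕ) → (Fin q → Tuple k m) →
       (Tuple k m → Tuple k a → Bool) → Strategy k m a n →
       Vec (Fin q) n → Bool
wins k m a q n Q V f e =
  and (List.map (λ i → V (Q (lookup e i)) (λ j → lookup (f j (playerVec Q j e)) i))
                (allFin n))

winProb : (k : ℕ) (m a : Fin k → ℕ) (q n : ℕ) → .{{NonZero q}} →
          (Fin q → Tuple k m) → (Tuple k m → Tuple k a → Bool) →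
          Strategy k m a n → ℚ
winProb k m a q n Q V f = frac (count q n (wins k m a q n Q V f)) q n

IsValueRep : (k : ℕ) (m a : Fin k → ℕ) (q n : ℕ) → .{{NonZero q}} →
             (Fin q → Tuple k m) → (Tuple k m → Tuple k a → Bool) → ℚ → Set
IsValueRep k m a q n Q V v =
  (∃ λ (f : Strategy k m a n) → winProb k m a q n Q V f ≡ v) ×
  (∀ (f : Strategy k m a n) → winProb k m a q n Q V f ≤ v)

-- E_Q(n).  A subset W ⊆ Qⁿ is a boolean predicate on index vectors.

ForbiddenSubgraph : (k : ℕ) (m : Fin k → ℕ) (q n : ℕ) → (Fin q → Tuple k m) →
                    (Vec (Fin q) n → Bool) → Set
ForbiddenSubgraph k m q n Q W =
  Σ (Fin q → Vec (Fin q) n) λ e → Σ (Fin n) λ i →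
    (∀ r → W (e r) ≡ true) ×
    (∀ s → ∃ λ r → lookup (e r) i ≡ s) ×
    (∀ j r r' → Q (lookup (e r) i) j ≡ Q (lookup (e r') i) j →
                playerVec Q j (e r) ≡ playerVec Q j (e r'))

IsEQ : (k : ℕ) (m : Fin k → ℕ) (q n : ℕ) → .{{NonZero q}} →
       (Fin q → Tuple k m) → ℚ → Set
IsEQ k m q n Q x =
  (∃ λ (W : Vec (Fin q) n → Bool) →
     ¬ ForbiddenSubgraph k m q n Q W × frac (count q n W) q n ≡ x) ×
  (∀ (W : Vec (Fin q) n → Bool) →
     ¬ ForbiddenSubgraph k m q n Q W → frac (count q n W) q n ≤ x)

-- Fix a largest set W* ⊆ Qⁿ containing no forbidden subgraph. Player j answers with a
-- coordinate p and a vector y ∈ (X⁽ʲ⁾)ⁿ, and V accepts the question tuple x when some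
-- w ∈ W* has w⁽ʲ⁾ = y for every j and x = w_p. Answering (i, own question vector) in
-- coordinate i wins on all of W*. Conversely, the winning set of any strategy contains no
-- forbidden subgraph: given one, at coordinate i, players who receive the same question
-- give the same answer, so the announced coordinate is constant along the edges of F_{X,Q},
-- hence constant by connectivity, and the announced vectors form a forbidden subgraph of W*
-- at that coordinate. Hence val(Gⁿ) = |W*| / qⁿ = E_Q(n).

{-# OPTIONS --safe #-}
module Submission where

open import Function using (_∘_; const; id; Injective)
open import Data.Nat as ℕ using (ℕ; zero; suc; _*_; _^_; NonZero; _≤_; z≤n)
import Data.Nat.Properties as ℕ
open import Algebra.Properties.CommutativeSemigroup ℕ.*-commutativeSemigroup using (interchange)
open import Data.Fin as Fin using (Fin; combine)
import Data.Fin.Properties as Fin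
open import Data.Vec as Vec using (Vec; []; _∷_; lookup; tabulate)
import Data.Vec.Properties as Vec
open import Data.List as List using (List; []; _∷_; [_]; concatMap; allFin; filter)
open import Data.List.Properties using (map-cong)
open import Data.List.Relation.Unary.Any as Any using (here; there)
open import Data.List.Relation.Unary.Any.Properties using (lookup-index)
import Data.List.Relation.Unary.All as All
open import Data.List.Relation.Unary.All.Properties using (all-filter)
open import Data.List.Relation.Unary.Enumerates.Setoid using (IsEnumeration)
open import Data.List.Membership.Propositional using (_∈_; lose)
open import Data.List.Membership.Propositional.Properties
  using (∈-map⁺; ∈-concatMap⁺; ∈-allFin; ∈-filter⁺)
open import Data.List.Extrema.Nat using (argmax; argmax-all; f[xs]≤f[argmax])
open import Data.Bool.ListAction using (and)
open import Data.Nat.ListAction using (sum)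
open import Data.Bool as Bool using (Bool; true; false; if_then_else_)
open import Data.Product using (Σ; _×_; ∃; _,_; proj₁; proj₂)
open import Data.Integer as ℤ using (+_)
import Data.Integer.Properties as ℤ
open import Data.Rational as ℚ using (ℚ; _/_)
open import Data.Rational.Properties using (toℚᵘ-cancel-≤; toℚᵘ-fromℚᵘ)
open import Data.Rational.Unnormalised as ℚᵘ using (mkℚᵘ)
import Data.Rational.Unnormalised.Properties as ℚᵘ
open import Relation.Nullary using (¬_; Dec; yes; no; does; map′)
open import Relation.Nullary.Decidable using (dec-true; _×-dec_; _→-dec_; ¬?)
open import Relation.Unary using (Decidable)
open import Relation.Binary.PropositionalEquality
  using (_≡_; refl; sym; trans; cong; cong₂; subst; subst₂; _≗_; setoid; module ≡-Reasoning)
open import Relation.Binary.Construct.Closure.ReflexiveTransitive using (Star; fold)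
open import Defs

private
  variable
    A B : Set

+/-mono-≤ : ∀ {a b} d .{{_ : NonZero d}} → a ≤ b → + a / d ℚ.≤ + b / d
+/-mono-≤ {a} {b} (suc d) a≤b =
  toℚᵘ-cancel-≤ (ℚᵘ.≤-respʳ-≃ (ℚᵘ.≃-sym (toℚᵘ-fromℚᵘ (mkℚᵘ (+ b) d)))
    (ℚᵘ.≤-respˡ-≃ (ℚᵘ.≃-sym (toℚᵘ-fromℚᵘ (mkℚᵘ (+ a) d)))
      (ℚᵘ.*≤* (ℤ.*-monoʳ-≤-nonNeg (+ suc d) (ℤ.+≤+ a≤b)))))

frac-mono-≤ : ∀ {a b} q n .{{_ : NonZero q}} → a ≤ b → frac a q n ℚ.≤ frac b q n
frac-mono-≤ q n = +/-mono-≤ (q ^ n) {{ℕ.m^n≢0 q n}}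

^-distribʳ-* : ∀ a b n → (a * b) ^ n ≡ a ^ n * b ^ n
^-distribʳ-* a b zero    = refl
^-distribʳ-* a b (suc n) = begin
  a * b * (a * b) ^ n        ≡⟨ cong (a * b *_) (^-distribʳ-* a b n) ⟩
  a * b * (a ^ n * b ^ n)    ≡⟨ interchange a b (a ^ n) (b ^ n) ⟩
  a * a ^ n * (b * b ^ n)    ∎
  where open ≡-Reasoning

prodFin-* : ∀ k (f g : Fin k → ℕ) →
            prodFin k (λ j → f j * g j) ≡ prodFin k f * prodFin k g
prodFin-* zero    f g = refl
prodFin-* (suc k) f g = begin
  f Fin.zero * g Fin.zero * prodFin k (λ j → f (Fin.suc j) * g (Fin.suc j))
    ≡⟨ cong (f Fin.zero * g Fin.zero *_) (prodFin-* k (f ∘ Fin.suc) (g ∘ Fin.suc)) ⟩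
  f Fin.zero * g Fin.zero * (prodFin k (f ∘ Fin.suc) * prodFin k (g ∘ Fin.suc))
    ≡⟨ interchange (f Fin.zero) (g Fin.zero) _ _ ⟩
  prodFin (suc k) f * prodFin (suc k) g ∎
  where open ≡-Reasoning

prodFin-const : ∀ k c → prodFin k (const c) ≡ c ^ k
prodFin-const zero    c = refl
prodFin-const (suc k) c = cong (c *_) (prodFin-const k c)

prodFin-^ : ∀ k (f : Fin k → ℕ) n → prodFin k (λ j → f j ^ n) ≡ prodFin k f ^ n
prodFin-^ zero    f n = sym (ℕ.^-zeroˡ n)
prodFin-^ (suc k) f n = begin
  f Fin.zero ^ n * prodFin k (λ j → f (Fin.suc j) ^ n)
    ≡⟨ cong (f Fin.zero ^ n *_) (prodFin-^ k (f ∘ Fin.suc) n) ⟩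
  f Fin.zero ^ n * prodFin k (f ∘ Fin.suc) ^ n
    ≡⟨ sym (^-distribʳ-* (f Fin.zero) (prodFin k (f ∘ Fin.suc)) n) ⟩
  prodFin (suc k) f ^ n ∎
  where open ≡-Reasoning

sum-map-mono-≤ : ∀ {f g : A → ℕ} xs → (∀ x → f x ≤ g x) →
                 sum (List.map f xs) ≤ sum (List.map g xs)
sum-map-mono-≤ []       f≤g = z≤n
sum-map-mono-≤ (x ∷ xs) f≤g = ℕ.+-mono-≤ (f≤g x) (sum-map-mono-≤ xs f≤g)

indicator-mono : ∀ {b b′ : Bool} → (b ≡ true → b′ ≡ true) →
                 (if b then 1 else 0) ≤ (if b′ then 1 else 0)
indicator-mono {true}  {true}  _ = ℕ.≤-refl
indicator-mono {true}  {false} b⇒b′ with () ← b⇒b′ refl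
indicator-mono {false}         _ = z≤n

count-mono : ∀ {q n} {P P′ : Vec (Fin q) n → Bool} →
             (∀ e → P e ≡ true → P′ e ≡ true) → count q n P ≤ count q n P′
count-mono {q} {n} P⇒P′ = sum-map-mono-≤ (allVecs q n) (indicator-mono ∘ P⇒P′)

count-cong : ∀ {q n} {P P′ : Vec (Fin q) n → Bool} → P ≗ P′ → count q n P ≡ count q n P′
count-cong {q} {n} P≗P′ =
  cong sum (map-cong (λ e → cong (λ b → if b then 1 else 0) (P≗P′ e)) (allVecs q n))

and-map≡true⁺ : ∀ {g : A → Bool} xs → (∀ x → g x ≡ true) → and (List.map g xs) ≡ true
and-map≡true⁺ []       g≡true = refl
and-map≡true⁺ (x ∷ xs) g≡true rewrite g≡true x = and-map≡true⁺ xs g≡true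

and-map≡true⁻ : ∀ {g : A → Bool} {x} xs → and (List.map g xs) ≡ true → x ∈ xs → g x ≡ true
and-map≡true⁻ {g = g} (y ∷ xs) all≡true (here refl) with g y
... | true  = refl
... | false with () ← all≡true
and-map≡true⁻ {g = g} (y ∷ xs) all≡true (there x∈xs) with g y
... | true  = and-map≡true⁻ xs all≡true x∈xs
... | false with () ← all≡true

dec-true⁻ : ∀ {P : Set} (P? : Dec P) → does P? ≡ true → P
dec-true⁻ (yes p) _ = p

Enumerates : (A : Set) → List A → Set
Enumerates A = IsEnumeration (setoid A)

bools : List Bool
bools = true ∷ false ∷ []

bools-enumerates : Enumerates Bool bools
bools-enumerates true  = here refl
bools-enumerates false = there (here refl)

vecs : List A → (n : ℕ) → List (Vec A n)
vecs xs zero    = [ [] ]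
vecs xs (suc n) = concatMap (λ x → List.map (x ∷_) (vecs xs n)) xs

vecs-enumerates : ∀ {xs} → Enumerates A xs → ∀ n → Enumerates (Vec A n) (vecs xs n)
vecs-enumerates xs-enum zero    [] = here refl
vecs-enumerates xs-enum (suc n) (x ∷ v) =
  ∈-concatMap⁺ (λ y → List.map (y ∷_) (vecs _ n))
    (Any.map (λ { refl → ∈-map⁺ (x ∷_) (vecs-enumerates xs-enum n v) }) (xs-enum x))

allVecs≡vecs : ∀ q n → allVecs q n ≡ vecs (allFin q) n
allVecs≡vecs q zero    = refl
allVecs≡vecs q (suc n) =
  cong (λ vs → concatMap (λ r → List.map (r ∷_) vs) (allFin q)) (allVecs≡vecs q n)

allVecs-enumerates : ∀ q n → Enumerates (Vec (Fin q) n) (allVecs q n)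
allVecs-enumerates q n =
  subst (Enumerates _) (sym (allVecs≡vecs q n)) (vecs-enumerates ∈-allFin n)

∃? : ∀ {xs} {P : A → Set} → Enumerates A xs → Decidable P → Dec (∃ P)
∃? {xs = xs} xs-enum P? =
  map′ Any.satisfied (λ (x , px) → lose (xs-enum x) px) (Any.any? P? xs)

∃-Fin→? : ∀ {xs} {q} {P : (Fin q → A) → Set} → Enumerates A xs →
          (∀ {e e′} → e ≗ e′ → P e → P e′) → Decidable P → Dec (∃ P)
∃-Fin→? {q = q} xs-enum P-resp P? =
  map′ (λ (v , pv) → lookup v , pv)
       (λ (e , pe) → tabulate e , P-resp (sym ∘ Vec.lookup∘tabulate e) pe)
       (∃? (vecs-enumerates xs-enum q) (P? ∘ lookup))

module _ {xs : List A} (xs-enum : Enumerates A xs) where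

  private
    index : A → Fin (List.length xs)
    index x = Any.index (xs-enum x)

  subsets : List (A → Bool)
  subsets = List.map (λ b x → lookup b (index x)) (vecs bools (List.length xs))

  subsets-complete : ∀ W → ∃ λ W′ → W′ ∈ subsets × W′ ≗ W
  subsets-complete W =
    _ , ∈-map⁺ _ (vecs-enumerates bools-enumerates _ b) ,
    λ x → trans (Vec.lookup∘tabulate _ (index x)) (cong W (sym (lookup-index (xs-enum x))))
    where
    b : Vec Bool (List.length xs)
    b = tabulate (W ∘ List.lookup xs)

  subset-maximum : (P : (A → Bool) → Set) → Decidable P → (∀ {W W′} → W ≗ W′ → P W → P W′) →
                   (c : (A → Bool) → ℕ) → (∀ {W W′} → W ≗ W′ → c W ≡ c W′) →
                   ∀ {W₀} → P W₀ → Σ (A → Bool) λ W* → P W* × (∀ W → P W → c W ≤ c W*)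
  subset-maximum P P? P-resp c c-resp {W₀} PW₀ = W* , PW* , maximal
    where
    candidates : List (A → Bool)
    candidates = filter P? subsets
    W* : A → Bool
    W* = argmax c W₀ candidates
    PW* : P W*
    PW* = argmax-all c PW₀ (all-filter P? subsets)
    maximal : ∀ W → P W → c W ≤ c W*
    maximal W PW with W′ , W′∈ , W′≗W ← subsets-complete W =
      subst (_≤ c W*) (c-resp W′≗W)
        (All.lookup (f[xs]≤f[argmax] W₀ candidates)
                    (∈-filter⁺ P? W′∈ (P-resp (sym ∘ W′≗W) PW)))

vecToFin : ∀ {m n} → Vec (Fin m) n → Fin (m ^ n)
vecToFin []      = Fin.zero
vecToFin (x ∷ v) = combine x (vecToFin v)

vecToFin-injective : ∀ {m n} → Injective _≡_ _≡_ (vecToFin {m} {n})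
vecToFin-injective {x = []}    {[]}    _  = refl
vecToFin-injective {x = x ∷ v} {y ∷ w} eq with refl , eq′ ← Fin.combine-injective x _ y _ eq =
  cong (x ∷_) (vecToFin-injective eq′)

locally-constant⇒constant : ∀ {k m q} {Q : Fin q → Tuple k m} →
  DistinctQ k m q Q → Connected k m q Q → (g : Fin q → B) →
  (∀ j s s′ → Q s j ≡ Q s′ j → g s ≡ g s′) → ∀ s s′ → g s′ ≡ g s
locally-constant⇒constant {k = zero} distinct _ g _ s s′ = cong g (distinct s′ s λ ())
locally-constant⇒constant {k = suc k} {m} {q} {Q} _ connected g local s s′ =
  propagate (connected (Fin.zero , Q s Fin.zero) (Fin.zero , Q s′ Fin.zero))
            (λ t → local Fin.zero t s) s′ refl
  where
  Constant : Vertex (suc k) m → Set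
  Constant (j , x) = ∀ t → Q t j ≡ x → g t ≡ g s
  step : ∀ {u v} → Edge (suc k) m q Q u v → Constant u → Constant v
  step {j , _} {j′ , _} (_ , t₀ , t₀j , t₀j′) const-u t tj′ =
    trans (local j′ t t₀ (trans tj′ (sym t₀j′))) (const-u t₀ t₀j)
  propagate : ∀ {u v} → Star (Edge (suc k) m q Q) u v → Constant u → Constant v
  propagate = fold (λ u v → Constant u → Constant v) (λ e c → c ∘ step e) id

module CanonicalForm {k} {m : Fin k → ℕ} {q} (Q : Fin q → Tuple k m) (n : ℕ) where

  Word : Set
  Word = Vec (Fin q) n

  CanonicalAt : (Word → Bool) → (Fin q → Word) → Fin n → Set
  CanonicalAt W e i =
    (∀ s → W (e s) ≡ true) ×
    (∀ s → lookup (e s) i ≡ s) ×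
    (∀ j s s′ → Q s j ≡ Q s′ j → playerVec Q j (e s) ≡ playerVec Q j (e s′))

  CanonicalForbiddenSubgraph : (Word → Bool) → Set
  CanonicalForbiddenSubgraph W = Σ (Fin q → Word) λ e → ∃ (CanonicalAt W e)

  forbidden⇒canonical : ∀ {W} → ForbiddenSubgraph k m q n Q W → CanonicalForbiddenSubgraph W
  forbidden⇒canonical (e , i , e∈W , onto , consistent) =
    e ∘ pick , i , e∈W ∘ pick , proj₂ ∘ onto ,
    λ j s s′ Qs≡Qs′ → consistent j (pick s) (pick s′)
      (subst₂ (λ t t′ → Q t j ≡ Q t′ j) (sym (proj₂ (onto s))) (sym (proj₂ (onto s′))) Qs≡Qs′)
    where
    pick : Fin q → Fin q
    pick s = proj₁ (onto s)

  canonical⇒forbidden : ∀ {W} → CanonicalForbiddenSubgraph W → ForbiddenSubgraph k m q n Q W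
  canonical⇒forbidden (e , i , e∈W , hit , consistent) =
    e , i , e∈W , (λ s → s , hit s) ,
    λ j r r′ eq → consistent j r r′ (subst₂ (λ t t′ → Q t j ≡ Q t′ j) (hit r) (hit r′) eq)

  canonical-resp : ∀ {W W′} → W ≗ W′ → CanonicalForbiddenSubgraph W → CanonicalForbiddenSubgraph W′
  canonical-resp W≗W′ (e , i , e∈W , rest) = e , i , (λ s → trans (sym (W≗W′ (e s))) (e∈W s)) , rest

  canonicalAt-resp : ∀ {W e e′} → e ≗ e′ → ∃ (CanonicalAt W e) → ∃ (CanonicalAt W e′)
  canonicalAt-resp {W} e≗e′ (i , e∈W , hit , consistent) =
    i ,
    (λ s → subst (λ v → W v ≡ true) (e≗e′ s) (e∈W s)) ,
    (λ s → subst (λ v → lookup v i ≡ s) (e≗e′ s) (hit s)) ,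
    λ j s s′ eq → subst₂ (λ v v′ → playerVec Q j v ≡ playerVec Q j v′) (e≗e′ s) (e≗e′ s′)
                         (consistent j s s′ eq)

  canonicalAt? : ∀ W e i → Dec (CanonicalAt W e i)
  canonicalAt? W e i =
    Fin.all? (λ s → W (e s) Bool.≟ true) ×-dec
    Fin.all? (λ s → lookup (e s) i Fin.≟ s) ×-dec
    Fin.all? λ j → Fin.all? λ s → Fin.all? λ s′ →
      Q s j Fin.≟ Q s′ j →-dec Vec.≡-dec Fin._≟_ (playerVec Q j (e s)) (playerVec Q j (e s′))

  canonical? : ∀ W → Dec (CanonicalForbiddenSubgraph W)
  canonical? W = ∃-Fin→? (allVecs-enumerates q n) (canonicalAt-resp {W}) (Fin.any? ∘ canonicalAt? W)

module Game {k} (m : Fin k → ℕ) {q} .{{_ : NonZero q}} (Q : Fin q → Tuple k m)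
            (Q-distinct : DistinctQ k m q Q) (Q-connected : Connected k m q Q) (n : ℕ) where

  open CanonicalForm Q n

  anchor : Fin q
  anchor = Fin.fromℕ< (ℕ.>-nonZero⁻¹ q)

  a : Fin k → ℕ
  a j = n * m j ^ n

  prodFin-a : prodFin k a ≡ n ^ k * prodFin k m ^ n
  prodFin-a = begin
    prodFin k (λ j → n * m j ^ n)                  ≡⟨ prodFin-* k (const n) (λ j → m j ^ n) ⟩
    prodFin k (const n) * prodFin k (λ j → m j ^ n) ≡⟨ cong₂ _*_ (prodFin-const k n) (prodFin-^ k m n) ⟩
    n ^ k * prodFin k m ^ n                         ∎
    where open ≡-Reasoning

  encode : ∀ {j} → Fin n × Vec (Fin (m j)) n → Fin (a j)
  encode (i , v) = combine i (vecToFin v)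

  encode-injective : ∀ {j} → Injective _≡_ _≡_ (encode {j})
  encode-injective {x = i , v} {i′ , v′} eq with refl , eq′ ← Fin.combine-injective i _ i′ _ eq =
    cong (i ,_) (vecToFin-injective eq′)

  empty-free : ¬ CanonicalForbiddenSubgraph (const false)
  empty-free (_ , _ , e∈∅ , _) with () ← e∈∅ anchor

  largest-free-set : Σ (Word → Bool) λ W* → ¬ CanonicalForbiddenSubgraph W* ×
                       (∀ W → ¬ CanonicalForbiddenSubgraph W → count q n W ≤ count q n W*)
  largest-free-set =
    subset-maximum (allVecs-enumerates q n) (¬_ ∘ CanonicalForbiddenSubgraph) (¬? ∘ canonical?)
      (λ W≗W′ free → free ∘ canonical-resp (sym ∘ W≗W′)) (count q n) count-cong empty-free

  W* : Word → Bool
  W* = proj₁ largest-free-set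

  W*-free : ¬ CanonicalForbiddenSubgraph W*
  W*-free = proj₁ (proj₂ largest-free-set)

  W*-largest : ∀ W → ¬ CanonicalForbiddenSubgraph W → count q n W ≤ count q n W*
  W*-largest = proj₂ (proj₂ largest-free-set)

  record Accepts (x : Tuple k m) (ans : Tuple k a) : Set where
    field
      witness      : Word
      coordinate   : Fin n
      witness∈W*   : W* witness ≡ true
      claims       : ∀ j → ans j ≡ encode (coordinate , playerVec Q j witness)
      asked        : ∀ j → Q (lookup witness coordinate) j ≡ x j

  accepts? : ∀ x ans → Dec (Accepts x ans)
  accepts? x ans =
    map′ (λ (w , p , w∈W* , cl , as) → record
           { witness = w ; coordinate = p ; witness∈W* = w∈W* ; claims = cl ; asked = as })
         (λ acc → let open Accepts acc in witness , coordinate , witness∈W* , claims , asked)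
         (∃? (allVecs-enumerates q n) λ w → Fin.any? λ p →
            W* w Bool.≟ true ×-dec
            Fin.all? (λ j → ans j Fin.≟ encode (p , playerVec Q j w)) ×-dec
            Fin.all? (λ j → Q (lookup w p) j Fin.≟ x j))

  V : Tuple k m → Tuple k a → Bool
  V x ans = does (accepts? x ans)

  Win : Strategy k m a n → Word → Bool
  Win = wins k m a q n Q V

  honest : Strategy k m a n
  honest j y = tabulate (λ i → encode (i , y))

  honest-wins : ∀ e → W* e ≡ true → Win honest e ≡ true
  honest-wins e e∈W* = and-map≡true⁺ (allFin n) λ i → dec-true (accepts? _ _) (record
    { witness = e ; coordinate = i ; witness∈W* = e∈W*
    ; claims = λ j → Vec.lookup∘tabulate _ i ; asked = λ j → refl })

  accepted-at : ∀ f e → Win f e ≡ true → ∀ i →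
                Accepts (Q (lookup e i)) (λ j → lookup (f j (playerVec Q j e)) i)
  accepted-at f e won i = dec-true⁻ (accepts? _ _) (and-map≡true⁻ (allFin n) won (∈-allFin i))

  pull-back : ∀ f → CanonicalForbiddenSubgraph (Win f) → CanonicalForbiddenSubgraph W*
  pull-back f (e , i , won , hit , consistent) =
    witness , P , witness∈W* , witness-hit , λ j s s′ → cong proj₂ ∘ same-claim j s s′
    where
    answer : Fin q → Tuple k a
    answer s j = lookup (f j (playerVec Q j (e s))) i

    accepted : ∀ s → Accepts (Q s) (answer s)
    accepted s = subst (λ t → Accepts (Q t) (answer s)) (hit s) (accepted-at f (e s) (won s) i)
    open module Accepted s = Accepts (accepted s)

    same-claim : ∀ j s s′ → Q s j ≡ Q s′ j →
                 (coordinate s , playerVec Q j (witness s)) ≡ (coordinate s′ , playerVec Q j (witness s′))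
    same-claim j s s′ Qs≡Qs′ = encode-injective (begin
      encode (coordinate s , playerVec Q j (witness s))   ≡⟨ sym (claims s j) ⟩
      answer s j                                          ≡⟨ cong (λ y → lookup (f j y) i) (consistent j s s′ Qs≡Qs′) ⟩
      answer s′ j                                         ≡⟨ claims s′ j ⟩
      encode (coordinate s′ , playerVec Q j (witness s′)) ∎)
      where open ≡-Reasoning

    P : Fin n
    P = coordinate anchor

    coordinate≡P : ∀ s → coordinate s ≡ P
    coordinate≡P = locally-constant⇒constant Q-distinct Q-connected coordinate
                     (λ j s s′ → cong proj₁ ∘ same-claim j s s′) anchor

    witness-hit : ∀ s → lookup (witness s) P ≡ s
    witness-hit s = Q-distinct _ _ λ j →
      trans (cong (λ p → Q (lookup (witness s) p) j) (sym (coordinate≡P s))) (asked s j)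

  Win-free : ∀ f → ¬ CanonicalForbiddenSubgraph (Win f)
  Win-free f = W*-free ∘ pull-back f

  value : ℚ
  value = frac (count q n W*) q n

  value-isValue : IsValueRep k m a q n Q V value
  value-isValue =
    (honest , cong (λ c → frac c q n)
                (ℕ.≤-antisym (W*-largest _ (Win-free honest)) (count-mono honest-wins))) ,
    λ f → frac-mono-≤ q n (W*-largest _ (Win-free f))

  value-isEQ : IsEQ k m q n Q value
  value-isEQ =
    (W* , W*-free ∘ forbidden⇒canonical {W*} , refl) ,
    λ W free → frac-mono-≤ q n (W*-largest W (free ∘ canonical⇒forbidden {W}))

theorem3p6 : (k : ℕ) (m : Fin k → ℕ) (q : ℕ) .{{_ : NonZero q}}
    (Q : Fin q → Tuple k m) → DistinctQ k m q Q → Connected k m q Q →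
    (n : ℕ) →
    Σ (Fin k → ℕ) λ a →
      (prodFin k a ≡ n ^ k * prodFin k m ^ n) ×
      Σ (Tuple k m → Tuple k a → Bool) λ V →
        Σ ℚ λ v → IsValueRep k m a q n Q V v × IsEQ k m q n Q v
theorem3p6 k m q Q Q-distinct Q-connected n =
  a , prodFin-a , V , value , value-isValue , value-isEQ
  where open Game m Q Q-distinct Q-connected n
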